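{- Let $G=(V,E)$ be a $k$-regular bipartite graph on $n$ vertices, where $k \geq 2$, and suppose that $n = 2j(k+1) + r$ for nonnegative integers $j, r$ with $4 \leq r < k+1$. Then $\gamma(G) > 2j+1 = \left\lceil \frac{n}{k+1} \right\rceil$.
   Context: A dominating set of a graph $G$ is a set $D$ of vertices such that every vertex is in $D$ or adjacent to a vertex of $D$; $\gamma(G)$ denotes the minimum size of a dominating set. -}

module Defs where

open import Data.Nat using (ℕ; suc; _+_; _*_; _<_)
open import Data.Bool using (Bool; true; false; T; _≟_)
open import Data.Fin using (Fin)
open import Data.Fin.Subset using (Subset; _∈_; ∣_∣)
open import Data.Vec using (tabulate)
open import Data.Product using (Σ; ∃; _×_)
open import Data.Sum using (_⊎_)
open import Relation.Binary.PropositionalEquality using (_≡_; _≢_)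

record Graph (n : ℕ) : Set where
  field
    adj     : Fin n → Fin n → Bool
    sym     : ∀ u v → adj u v ≡ adj v u
    irrefl  : ∀ v → adj v v ≡ false

open Graph public

nbhd : ∀ {n} → Graph n → Fin n → Subset n
nbhd G v = tabulate (λ u → adj G v u)

degree : ∀ {n} → Graph n → Fin n → ℕ
degree G v = ∣ nbhd G v ∣

IsRegular : ∀ {n} → Graph n → ℕ → Set
IsRegular G k = ∀ v → degree G v ≡ k

IsBipartite : ∀ {n} → Graph n → Set
IsBipartite {n} G = Σ (Fin n → Bool) λ c → ∀ u v → T (adj G u v) → c u ≢ c v

IsDominating : ∀ {n} → Graph n → Subset n → Set
IsDominating {n} G D = ∀ v → v ∈ D ⊎ ∃ λ u → u ∈ D × T (adj G u v)

DominationNumberGreaterThan : ∀ {n} → Graph n → ℕ → Set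
DominationNumberGreaterThan G m = ∀ D → IsDominating G D → m < ∣ D ∣

-- Let A and B be the colour classes of G. Counting edges gives k|A| = k|B|, so
-- |A| = |B| = n/2. If D dominates G, a vertex of B outside D has a neighbour in
-- D ∩ A and every vertex of D ∩ A has only k neighbours, so |B| ≤ |D ∩ B| + k|D ∩ A|,
-- and symmetrically for A. If |D| ≤ 2j + 1, the smaller of |D ∩ A|, |D ∩ B| is at
-- most j, and the corresponding bound gives n/2 ≤ 2j + 1 + (k − 1)j, i.e. r ≤ 2.
module Submission where

open import Defs
open import Data.Nat using (ℕ; zero; suc; _+_; _*_; _≤_; _<_; _/_; z≤n; s≤s; s≤s⁻¹; NonZero)
open import Data.Nat.Properties
open import Data.Nat.DivMod using (+-distrib-/-∣ˡ; m*n/n≡m; m<n⇒m/n≡0; /-congˡ)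
open import Data.Nat.Divisibility using (divides)
open import Data.Nat.Tactic.RingSolver using (solve-∀)
open import Algebra.Properties.Semiring.Sum +-*-semiring
  using (sum; sum-syntax; sum-cong-≗; ∑-comm; ∑-distrib-+; *-distribˡ-sum; *-distribʳ-sum)
open import Data.Bool using (Bool; true; false; T; not; _∧_)
open import Data.Bool.Properties using (not-involutive; not-injective; T-≡; T-∧)
open import Data.Fin using (Fin; zero; suc)
open import Data.Fin.Subset using (Subset; ∣_∣)
open import Data.Vec using ([]; _∷_; lookup)
open import Data.Vec.Properties using (lookup∘tabulate; []=⇒lookup)
open import Data.Product using (_×_; _,_; proj₁; proj₂)
open import Data.Sum using (inj₁; inj₂)
open import Data.Unit using (tt)
open import Data.Empty using (⊥; ⊥-elim)
open import Function using (_∘_; Equivalence)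
open import Relation.Nullary using (¬_)
open import Relation.Binary.PropositionalEquality as ≡ using (_≡_; _≢_; refl; cong; cong₂)

𝟙 : Bool → ℕ
𝟙 true  = 1
𝟙 false = 0

T⇒𝟙≡1 : ∀ {b} → T b → 𝟙 b ≡ 1
T⇒𝟙≡1 {true} _ = refl

¬T⇒T-not : ∀ {b} → ¬ T b → T (not b)
¬T⇒T-not {true}  ¬Tb = ¬Tb tt
¬T⇒T-not {false} _   = tt

𝟙-split : ∀ x y → 𝟙 x ≡ 𝟙 (x ∧ y) + 𝟙 (x ∧ not y)
𝟙-split true  true  = refl
𝟙-split true  false = refl
𝟙-split false _     = refl

sum-mono-≤ : ∀ {n} {f g : Fin n → ℕ} → (∀ i → f i ≤ g i) → sum f ≤ sum g
sum-mono-≤ {zero}  _   = z≤n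
sum-mono-≤ {suc n} f≤g = +-mono-≤ (f≤g zero) (sum-mono-≤ (f≤g ∘ suc))

term≤sum : ∀ {n} (f : Fin n → ℕ) i → f i ≤ sum f
term≤sum f zero    = m≤m+n _ _
term≤sum f (suc i) = ≤-trans (term≤sum (f ∘ suc) i) (m≤n+m _ _)

count : ∀ {n} → (Fin n → Bool) → ℕ
count {n} p = ∑[ i < n ] 𝟙 (p i)

count-true : ∀ n → count {n} (λ _ → true) ≡ n
count-true zero    = refl
count-true (suc n) = cong suc (count-true n)

count-split : ∀ {n} (p q : Fin n → Bool) →
              count p ≡ count (λ i → p i ∧ q i) + count (λ i → p i ∧ not (q i))
count-split p q = ≡.trans (sum-cong-≗ (λ i → 𝟙-split (p i) (q i)))
                          (∑-distrib-+ (λ i → 𝟙 (p i ∧ q i)) (λ i → 𝟙 (p i ∧ not (q i))))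

∣p∣≡count : ∀ {n} (p : Subset n) → ∣ p ∣ ≡ count (lookup p)
∣p∣≡count []          = refl
∣p∣≡count (true ∷ p)  = cong suc (∣p∣≡count p)
∣p∣≡count (false ∷ p) = ∣p∣≡count p

IsIndependent : ∀ {n} → Graph n → (Fin n → Bool) → Set
IsIndependent G S = ∀ u v → T (adj G u v) → T (S u) → T (S v) → ⊥

IsProperColouring : ∀ {n} → Graph n → (Fin n → Bool) → Set
IsProperColouring G c = ∀ u v → T (adj G u v) → c u ≢ c v

module _ {n} (G : Graph n) {c : Fin n → Bool} (proper : IsProperColouring G c) where

  properColouring-not : IsProperColouring G (not ∘ c)
  properColouring-not u v u~v = proper u v u~v ∘ not-injective

  colourClass-independent : IsIndependent G c
  colourClass-independent u v u~v cu cv =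
    proper u v u~v (≡.trans (Equivalence.to T-≡ cu) (≡.sym (Equivalence.to T-≡ cv)))

𝟙-properEdge : ∀ a b e → (T e → a ≢ b) → 𝟙 a * 𝟙 e ≡ 𝟙 (not b) * 𝟙 e
𝟙-properEdge a     b     false _  = ≡.trans (*-zeroʳ (𝟙 a)) (≡.sym (*-zeroʳ (𝟙 (not b))))
𝟙-properEdge true  true  true  a≢b = ⊥-elim (a≢b tt refl)
𝟙-properEdge true  false true  _  = refl
𝟙-properEdge false true  true  _  = refl
𝟙-properEdge false false true  a≢b = ⊥-elim (a≢b tt refl)

module _ {n k} (G : Graph n) (regular : IsRegular G k) where

  count-adj : ∀ u → count (adj G u) ≡ k
  count-adj u = begin
    count (adj G u)            ≡⟨ sum-cong-≗ (λ v → cong 𝟙 (lookup∘tabulate (adj G u) v)) ⟨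
    count (lookup (nbhd G u))  ≡⟨ ∣p∣≡count (nbhd G u) ⟨
    degree G u                 ≡⟨ regular u ⟩
    k                          ∎
    where open ≡.≡-Reasoning

  weighted-handshake : ∀ (f : Fin n → ℕ) →
                       ∑[ u < n ] ∑[ v < n ] (f u * 𝟙 (adj G u v)) ≡ k * sum f
  weighted-handshake f = begin
    ∑[ u < n ] ∑[ v < n ] (f u * 𝟙 (adj G u v))
      ≡⟨ sum-cong-≗ (λ u → *-distribˡ-sum (f u) (𝟙 ∘ adj G u)) ⟨
    ∑[ u < n ] (f u * count (adj G u))  ≡⟨ sum-cong-≗ (λ u → cong (f u *_) (count-adj u)) ⟩
    ∑[ u < n ] (f u * k)                ≡⟨ *-distribʳ-sum k f ⟨
    sum f * k                           ≡⟨ *-comm _ k ⟩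
    k * sum f                           ∎
    where open ≡.≡-Reasoning

  properColouring-balanced : .{{_ : NonZero k}} → ∀ {c} → IsProperColouring G c →
                             count c ≡ count (not ∘ c)
  properColouring-balanced {c} proper = *-cancelˡ-≡ _ _ k (begin
    k * count c
      ≡⟨ weighted-handshake (𝟙 ∘ c) ⟨
    ∑[ u < n ] ∑[ v < n ] (𝟙 (c u) * 𝟙 (adj G u v))
      ≡⟨ sum-cong-≗ (λ u → sum-cong-≗ (λ v → 𝟙-properEdge (c u) (c v) (adj G u v) (proper u v))) ⟩
    ∑[ u < n ] ∑[ v < n ] (𝟙 (not (c v)) * 𝟙 (adj G u v))
      ≡⟨ ∑-comm (λ u v → 𝟙 (not (c v)) * 𝟙 (adj G u v)) ⟩
    ∑[ v < n ] ∑[ u < n ] (𝟙 (not (c v)) * 𝟙 (adj G u v))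
      ≡⟨ sum-cong-≗ (λ v → sum-cong-≗ (λ u → cong (λ e → 𝟙 (not (c v)) * 𝟙 e) (Graph.sym G u v))) ⟩
    ∑[ v < n ] ∑[ u < n ] (𝟙 (not (c v)) * 𝟙 (adj G v u))
      ≡⟨ weighted-handshake (𝟙 ∘ not ∘ c) ⟩
    k * count (not ∘ c)
      ∎)
    where open ≡.≡-Reasoning

  independent-dominated : ∀ {D S} → IsDominating G D → IsIndependent G S →
                          count S ≤ count (λ v → lookup D v ∧ S v)
                                    + k * count (λ u → lookup D u ∧ not (S u))
  independent-dominated {D} {S} dominating independent = begin
    count S
      ≤⟨ sum-mono-≤ dominated ⟩
    ∑[ v < n ] (𝟙 (lookup D v ∧ S v) + ∑[ u < n ] (outside u * 𝟙 (adj G u v)))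
      ≡⟨ ∑-distrib-+ (λ v → 𝟙 (lookup D v ∧ S v)) (λ v → ∑[ u < n ] (outside u * 𝟙 (adj G u v))) ⟩
    count (λ v → lookup D v ∧ S v) + (∑[ v < n ] ∑[ u < n ] (outside u * 𝟙 (adj G u v)))
      ≡⟨ cong (count (λ v → lookup D v ∧ S v) +_)
              (≡.trans (∑-comm (λ v u → outside u * 𝟙 (adj G u v))) (weighted-handshake outside)) ⟩
    count (λ v → lookup D v ∧ S v) + k * sum outside
      ∎
    where
    open ≤-Reasoning
    outside : Fin n → ℕ
    outside u = 𝟙 (lookup D u ∧ not (S u))

    dominated : ∀ v → 𝟙 (S v) ≤ 𝟙 (lookup D v ∧ S v) + ∑[ u < n ] (outside u * 𝟙 (adj G u v))
    dominated v with S v in Sv | dominating v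
    ... | false | _ = z≤n
    ... | true  | inj₁ v∈D rewrite []=⇒lookup v∈D = s≤s z≤n
    ... | true  | inj₂ (u , u∈D , u~v) = ≤-trans neighbour (m≤n+m _ _)
      where
      u∉S : T (not (S u))
      u∉S = ¬T⇒T-not (λ Su → independent u v u~v Su (Equivalence.from T-≡ Sv))
      u∈D∖S : T (lookup D u ∧ not (S u))
      u∈D∖S = Equivalence.from T-∧ (Equivalence.from T-≡ ([]=⇒lookup u∈D) , u∉S)
      neighbour : 1 ≤ ∑[ u < n ] (outside u * 𝟙 (adj G u v))
      neighbour = begin
        1                                       ≡⟨ cong₂ _*_ (T⇒𝟙≡1 u∈D∖S) (T⇒𝟙≡1 u~v) ⟨
        outside u * 𝟙 (adj G u v)               ≤⟨ term≤sum (λ u → outside u * 𝟙 (adj G u v)) u ⟩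
        ∑[ u < n ] (outside u * 𝟙 (adj G u v))  ∎

  colourClass-size : .{{_ : NonZero k}} → ∀ {c} → IsProperColouring G c → count c + count c ≡ n
  colourClass-size {c} proper = begin
    count c + count c          ≡⟨ cong (count c +_) (properColouring-balanced proper) ⟩
    count c + count (not ∘ c)  ≡⟨ count-split (λ _ → true) c ⟨
    count {n} (λ _ → true)     ≡⟨ count-true n ⟩
    n                          ∎
    where open ≡.≡-Reasoning

  colourClass-dominated : .{{_ : NonZero k}} → ∀ {c D} → IsProperColouring G c → IsDominating G D →
    let a = count (λ v → lookup D v ∧ c v)
        b = count (λ v → lookup D v ∧ not (c v))
    in count c ≤ a + k * b × count c ≤ b + k * a
  colourClass-dominated {c} {D} proper dominating =
    independent-dominated dominating (colourClass-independent G proper) , (begin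
      count c
        ≡⟨ properColouring-balanced proper ⟩
      count (not ∘ c)
        ≤⟨ independent-dominated dominating (colourClass-independent G (properColouring-not G proper)) ⟩
      b + k * count (λ v → lookup D v ∧ not (not (c v)))
        ≡⟨ cong (λ x → b + k * x)
                (sum-cong-≗ (λ v → cong (λ x → 𝟙 (lookup D v ∧ x)) (not-involutive (c v)))) ⟩
      b + k * a
        ∎)
    where
    open ≤-Reasoning
    a b : ℕ
    a = count (λ v → lookup D v ∧ c v)
    b = count (λ v → lookup D v ∧ not (c v))

half-≤ : ∀ {a j} → a + a ≤ 2 * j + 1 → a ≤ j
half-≤ {a} {j} a+a≤ = s≤s⁻¹ (*-cancelˡ-< 2 a (suc j) (begin-strict
  2 * a      ≡⟨ 2*a≡a+a a ⟩
  a + a      ≤⟨ a+a≤ ⟩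
  2 * j + 1  <⟨ ≤-reflexive (1+[2j+1]≡2[1+j] j) ⟩
  2 * suc j  ∎))
  where
  open ≤-Reasoning
  2*a≡a+a : ∀ a → 2 * a ≡ a + a
  2*a≡a+a = solve-∀
  1+[2j+1]≡2[1+j] : ∀ j → suc (2 * j + 1) ≡ 2 * suc j
  1+[2j+1]≡2[1+j] = solve-∀

smallerPart-bound⇒r≤2 : ∀ m {j r a b A} → a ≤ b → a + b ≤ 2 * j + 1 → A ≤ b + suc m * a →
                        A + A ≡ 2 * j * (suc m + 1) + r → r ≤ 2
smallerPart-bound⇒r≤2 m {j} {r} {a} {b} {A} a≤b a+b≤ A≤b+ka A+A≡ =
  +-cancelˡ-≤ (2 * j * (suc m + 1)) r 2 (begin
    2 * j * (suc m + 1) + r  ≡⟨ A+A≡ ⟨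
    A + A                    ≤⟨ +-mono-≤ A≤M A≤M ⟩
    M + M                    ≡⟨ M+M≡ j m ⟩
    2 * j * (suc m + 1) + 2  ∎)
  where
  open ≤-Reasoning
  M : ℕ
  M = 2 * j + 1 + m * j
  M+M≡ : ∀ j m → (2 * j + 1 + m * j) + (2 * j + 1 + m * j) ≡ 2 * j * (suc m + 1) + 2
  M+M≡ = solve-∀
  regroup : ∀ a b m → b + suc m * a ≡ a + b + m * a
  regroup = solve-∀
  a≤j : a ≤ j
  a≤j = half-≤ (≤-trans (+-monoʳ-≤ a a≤b) a+b≤)
  A≤M : A ≤ M
  A≤M = begin
    A                ≤⟨ A≤b+ka ⟩
    b + suc m * a    ≡⟨ regroup a b m ⟩
    a + b + m * a    ≤⟨ +-mono-≤ a+b≤ (*-monoʳ-≤ m a≤j) ⟩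
    M                ∎

split-bounds⇒r≤2 : ∀ m {j r a b A} → a + b ≤ 2 * j + 1 → A ≤ a + suc m * b → A ≤ b + suc m * a →
                   A + A ≡ 2 * j * (suc m + 1) + r → r ≤ 2
split-bounds⇒r≤2 m {j} {r} {a} {b} a+b≤ A≤a+kb A≤b+ka A+A≡ with ≤-total a b
... | inj₁ a≤b = smallerPart-bound⇒r≤2 m {j} {r} a≤b a+b≤ A≤b+ka A+A≡
... | inj₂ b≤a = smallerPart-bound⇒r≤2 m {j} {r} b≤a (≤-trans (≤-reflexive (+-comm b a)) a+b≤)
                                       A≤a+kb A+A≡

[m*n+o]/n≡m : ∀ m {n o} .{{_ : NonZero n}} → o < n → (m * n + o) / n ≡ m
[m*n+o]/n≡m m {n} {o} o<n = begin
  (m * n + o) / n    ≡⟨ +-distrib-/-∣ˡ o (divides m refl) ⟩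
  m * n / n + o / n  ≡⟨ cong₂ _+_ (m*n/n≡m m n) (m<n⇒m/n≡0 o<n) ⟩
  m + 0              ≡⟨ +-identityʳ m ⟩
  m                  ∎
  where open ≡.≡-Reasoning

ceiling-quotient : ∀ q k {r} → 0 < r → r < k + 1 → (q * (k + 1) + r + k) / suc k ≡ q + 1
ceiling-quotient q k {suc s} (s≤s z≤n) r<k+1 = begin
  (q * (k + 1) + suc s + k) / suc k  ≡⟨ /-congˡ (regroup q k s) ⟩
  ((q + 1) * suc k + s) / suc k      ≡⟨ [m*n+o]/n≡m (q + 1) s<1+k ⟩
  q + 1                              ∎
  where
  open ≡.≡-Reasoning
  regroup : ∀ q k s → q * (k + 1) + suc s + k ≡ (q + 1) * suc k + s
  regroup = solve-∀
  s<1+k : s < suc k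
  s<1+k = ≤-trans (n≤1+n (suc s)) (≤-trans r<k+1 (≤-reflexive (+-comm k 1)))

proposition13 : (n k j r : ℕ) → (G : Graph n) → IsRegular G k → IsBipartite G
    → 2 ≤ k → n ≡ 2 * j * (k + 1) + r → 4 ≤ r → r < k + 1
    → DominationNumberGreaterThan G (2 * j + 1)
      × (n + k) / suc k ≡ 2 * j + 1
proposition13 n (suc m) j r G regular (c , proper) (s≤s _) n≡ 4≤r r<k+1 = dominates , quotient
  where
  quotient : (n + suc m) / suc (suc m) ≡ 2 * j + 1
  quotient = ≡.trans (/-congˡ (cong (_+ suc m) n≡))
                     (ceiling-quotient (2 * j) (suc m) (≤-trans (s≤s z≤n) 4≤r) r<k+1)

  dominates : DominationNumberGreaterThan G (2 * j + 1)
  dominates D dominating = ≰⇒> λ |D|≤2j+1 → ≤⇒≯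
    (split-bounds⇒r≤2 m {j} {r} {a} {b} (≤-trans (≤-reflexive a+b≡|D|) |D|≤2j+1) A≤a+kb A≤b+ka
                       (≡.trans (colourClass-size G regular proper) n≡))
    (≤-trans (n≤1+n 3) 4≤r)
    where
    a b : ℕ
    a = count (λ v → lookup D v ∧ c v)
    b = count (λ v → lookup D v ∧ not (c v))
    a+b≡|D| : a + b ≡ ∣ D ∣
    a+b≡|D| = ≡.sym (≡.trans (∣p∣≡count D) (count-split (lookup D) c))
    A≤a+kb : count c ≤ a + suc m * b
    A≤a+kb = proj₁ (colourClass-dominated G regular proper dominating)
    A≤b+ka : count c ≤ b + suc m * a
    A≤b+ka = proj₂ (colourClass-dominated G regular proper dominating)
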